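{- Let $w\geq 5$ and let $B=\{(0,0,0,0,0),(0,0,1,0,0),(0,0,0,1,0),(0,0,0,0,1),(1,0,1,0,0),(0,1,0,1,0),(0,0,1,0,1),(0,0,0,1,1),(1,1,1,1,1),(1,1,0,1,1),(1,1,1,0,1),(1,1,1,1,0),(0,1,0,1,1),(1,0,1,0,1),(1,1,0,1,0),(1,1,1,0,0)\}$. Define $C_1=\{(x_1,\dots,x_{2w})\in J(2w,w) : (x_1,x_2,x_3,x_4,x_5)\in B\}$ and $C_2=V(J(2w,w))\setminus C_1$. Then $(C_1,C_2)$ is an equitable partition of $J(2w,w)$ with quotient matrix $\begin{pmatrix} w^2-2w & 2w\\ 2w-2 & w^2-2w+2\end{pmatrix}$.
   Context: The Johnson graph $J(n,w)$ has as vertices the binary vectors of length $n$ with exactly $w$ ones; two vertices are adjacent if they have exactly $w-1$ common ones. A partition $(C_1,C_2)$ of the vertex set of a graph is equitable with quotient matrix $S=(s_{ij})_{i,j\in\{1,2\}}$ if every vertex of $C_i$ has exactly $s_{ij}$ neighbours in $C_j$. -}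

module Defs where

open import Data.Nat using (ℕ; zero; suc; _+_; _*_; _∸_)
open import Data.Bool using (Bool; true; false; _∧_; if_then_else_)
open import Data.Vec using (Vec; []; _∷_; take; zipWith)
open import Data.List using (List; []; _∷_; _++_; map; filter; length; concatMap)
open import Data.Fin using (Fin)
open import Data.Product using (_×_)
open import Relation.Nullary using (¬_)
open import Relation.Nullary.Decidable using (Dec; yes; no; _×-dec_; ¬?; does)
open import Relation.Unary using (Pred; Decidable)
open import Data.List.Membership.DecPropositional using ()
open import Relation.Binary.PropositionalEquality using (_≡_)
open import Data.Nat using (_≟_)
import Data.Vec.Properties as VecP
import Data.Bool.Properties as BoolP
open import Data.List.Membership.Propositional using (_∈_)
import Data.List.Membership.DecPropositional as DecMem
open import Level using (0ℓ)

weight : ∀ {n} → Vec Bool n → ℕ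
weight []           = 0
weight (true  ∷ xs) = suc (weight xs)
weight (false ∷ xs) = weight xs

common : ∀ {n} → Vec Bool n → Vec Bool n → ℕ
common x y = weight (zipWith _∧_ x y)

allVecs : (n : ℕ) → List (Vec Bool n)
allVecs zero    = [] ∷ []
allVecs (suc n) = map (true ∷_) (allVecs n) ++ map (false ∷_) (allVecs n)

-- vertex set of the Johnson graph J(n,w)
IsVertex : (n w : ℕ) → Vec Bool n → Set
IsVertex n w x = weight x ≡ w

isVertex? : (n w : ℕ) → Decidable (IsVertex n w)
isVertex? n w x = weight x ≟ w

vertices : (n w : ℕ) → List (Vec Bool n)
vertices n w = filter (isVertex? n w) (allVecs n)

Adj : (n w : ℕ) → Vec Bool n → Vec Bool n → Set
Adj n w x y = common x y ≡ w ∸ 1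

adj? : (n w : ℕ) (x y : Vec Bool n) → Dec (Adj n w x y)
adj? n w x y = common x y ≟ w ∸ 1

neighboursIn : (n w : ℕ) (C : Pred (Vec Bool n) 0ℓ) → Decidable C → Vec Bool n → ℕ
neighboursIn n w C C? x =
  length (filter (λ y → adj? n w x y ×-dec C? y) (vertices n w))

IsEquitable2 : (n w : ℕ) (C₁ : Pred (Vec Bool n) 0ℓ) → Decidable C₁ →
               (s11 s12 s21 s22 : ℕ) → Set
IsEquitable2 n w C₁ C₁? s11 s12 s21 s22 =
  (∀ x → IsVertex n w x → C₁ x →
     neighboursIn n w C₁ C₁? x ≡ s11 × neighboursIn n w (λ y → ¬ C₁ y) (λ y → ¬? (C₁? y)) x ≡ s12)
  × (∀ x → IsVertex n w x → ¬ C₁ x →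
     neighboursIn n w C₁ C₁? x ≡ s21 × neighboursIn n w (λ y → ¬ C₁ y) (λ y → ¬? (C₁? y)) x ≡ s22)

-- the set B ⊆ {0,1}^5 from the paper (1 = true, 0 = false)
B : List (Vec Bool 5)
B = (false ∷ false ∷ false ∷ false ∷ false ∷ [])
  ∷ (false ∷ false ∷ true  ∷ false ∷ false ∷ [])
  ∷ (false ∷ false ∷ false ∷ true  ∷ false ∷ [])
  ∷ (false ∷ false ∷ false ∷ false ∷ true  ∷ [])
  ∷ (true  ∷ false ∷ true  ∷ false ∷ false ∷ [])
  ∷ (false ∷ true  ∷ false ∷ true  ∷ false ∷ [])
  ∷ (false ∷ false ∷ true  ∷ false ∷ true  ∷ [])
  ∷ (false ∷ false ∷ false ∷ true  ∷ true  ∷ [])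
  ∷ (true  ∷ true  ∷ true  ∷ true  ∷ true  ∷ [])
  ∷ (true  ∷ true  ∷ false ∷ true  ∷ true  ∷ [])
  ∷ (true  ∷ true  ∷ true  ∷ false ∷ true  ∷ [])
  ∷ (true  ∷ true  ∷ true  ∷ true  ∷ false ∷ [])
  ∷ (false ∷ true  ∷ false ∷ true  ∷ true  ∷ [])
  ∷ (true  ∷ false ∷ true  ∷ false ∷ true  ∷ [])
  ∷ (true  ∷ true  ∷ false ∷ true  ∷ false ∷ [])
  ∷ (true  ∷ true  ∷ true  ∷ false ∷ false ∷ [])
  ∷ []

C₁ : (m : ℕ) → Vec Bool (5 + m) → Set
C₁ m x = take 5 x ∈ B

C₁? : (m : ℕ) → Decidable (C₁ m)
C₁? m x = DecMem._∈?_ (VecP.≡-dec BoolP._≟_) (take 5 x) B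

module Submission where

-- Split a vertex of J(5 + m, w) as x = a ++ t with a prefix a of
-- length 5.  A neighbour y of x is obtained by moving exactly one 1, so if y
-- has prefix a' then the prefix change (a ↦ a') already moves L ones out and
-- G ones in, and the tail has to supply the remaining 1 ∸ L and 1 ∸ G moves.
-- Hence the number of neighbours with prefix a' is a product of two linear
-- forms in the number p of ones and z of zeros of the tail, and the number of
-- neighbours in a set defined by prefixes is a bilinear polynomial in (p, z)
-- depending only on a.  In J(2w, w) with w = 5 + n the tail has
-- p = n + (zeros of a) and z = n + (ones of a), so every neighbour count is a
-- quadratic polynomial in n determined by the prefix a alone.  A finite check
-- over the 32 prefixes shows that these quadratics are the rows of the
-- quotient matrix, which gives the theorem.

open import Defs
open import Data.Nat using (ℕ; zero; suc; _+_; _*_; _∸_; _≤_; z≤n; s≤s; _≡ᵇ_; _≟_)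
open import Relation.Binary.PropositionalEquality using (_≡_)

open import Data.Nat.Properties
  using (+-identityʳ; +-suc; +-comm; +-assoc; +-cancelˡ-≡; *-identityˡ; *-zeroʳ;
         *-distribʳ-+; *-distribˡ-+; m+n∸n≡m; suc-injective)
open import Data.Nat.Combinatorics using (_C_; nC1≡n; nCk+nC[k+1]≡[n+1]C[k+1])
open import Data.Nat.Tactic.RingSolver using (solve-∀)
open import Data.Bool using (Bool; true; false; _∧_; not; if_then_else_)
open import Data.Bool.Properties using (∧-zeroʳ; ∧-assoc; ∧-comm)
import Data.Bool.Properties as BoolP
open import Data.Vec using (Vec; []; _∷_; _++_)
open import Data.Vec.Properties using (zipWith-comm)
import Data.Vec.Properties as VecP
open import Data.List using (List; []; _∷_; map; filter; length)
import Data.List as List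
open import Data.List.Properties using (map-++; map-∘; map-cong)
open import Data.Nat.ListAction using (sum)
open import Data.Nat.ListAction.Properties using (sum-++)
open import Data.List.Membership.Propositional using (_∈_)
open import Data.List.Membership.Propositional.Properties using (∈-map⁺; ∈-++⁺ˡ; ∈-++⁺ʳ)
import Data.List.Membership.DecPropositional as DecMem
open import Data.List.Relation.Unary.All using (All; all?)
import Data.List.Relation.Unary.All as All
open import Data.List.Relation.Unary.Any using (here)
open import Data.Product using (_×_; _,_; proj₁; proj₂)
open import Data.Product.Properties using (≡-dec)
open import Data.Unit using (tt)
open import Function using (_∘_; _⇔_; mk⇔)
open import Level using (0ℓ)
open import Relation.Binary.PropositionalEquality using (refl; sym; trans; cong; cong₂; module ≡-Reasoning)
open import Relation.Nullary using (Dec; ¬_)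
open import Relation.Nullary.Decidable using (does; _×-dec_; ¬?; dec-true; dec-false; does-⇔; toWitness)
open import Relation.Unary using (Pred; Decidable)

open ≡-Reasoning

-- Counting over the cube {0,1}^n

count : {A : Set} → (A → Bool) → List A → ℕ
count f xs = sum (map (λ x → if f x then 1 else 0) xs)

count-cong : ∀ {A : Set} {f g : A → Bool} → (∀ x → f x ≡ g x) → ∀ xs → count f xs ≡ count g xs
count-cong f≗g xs = cong sum (map-cong (λ x → cong (λ b → if b then 1 else 0) (f≗g x)) xs)

count-none : ∀ {A : Set} {f : A → Bool} → (∀ x → f x ≡ false) → ∀ xs → count f xs ≡ 0
count-none never []       = refl
count-none never (x ∷ xs) rewrite never x = count-none never xs

count-guard : ∀ {A : Set} (b : Bool) (f : A → Bool) xs →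
  count (λ x → b ∧ f x) xs ≡ (if b then count f xs else 0)
count-guard true  f xs = refl
count-guard false f xs = count-none (λ _ → refl) xs

length-filter : ∀ {A : Set} {P : Pred A 0ℓ} (P? : Decidable P) xs →
  length (filter P? xs) ≡ count (λ x → does (P? x)) xs
length-filter P? []       = refl
length-filter P? (x ∷ xs) with does (P? x)
... | true  = cong suc (length-filter P? xs)
... | false = length-filter P? xs

count-filter : ∀ {A : Set} {P : Pred A 0ℓ} (P? : Decidable P) (f : A → Bool) xs →
  count f (filter P? xs) ≡ count (λ x → does (P? x) ∧ f x) xs
count-filter P? f []       = refl
count-filter P? f (x ∷ xs) with does (P? x)
... | true  = cong ((if f x then 1 else 0) +_) (count-filter P? f xs)
... | false = count-filter P? f xs

allVecs-complete : ∀ {n} (v : Vec Bool n) → v ∈ allVecs n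
allVecs-complete []          = here refl
allVecs-complete (true  ∷ v) = ∈-++⁺ˡ (∈-map⁺ (true ∷_) (allVecs-complete v))
allVecs-complete (false ∷ v) = ∈-++⁺ʳ (map (true ∷_) (allVecs _)) (∈-map⁺ (false ∷_) (allVecs-complete v))

sum-allVecs-suc : ∀ {n} (g : Vec Bool (suc n) → ℕ) →
  sum (map g (allVecs (suc n)))
    ≡ sum (map (g ∘ (true ∷_)) (allVecs n)) + sum (map (g ∘ (false ∷_)) (allVecs n))
sum-allVecs-suc {n} g = begin
    sum (map g (map (true ∷_) vs List.++ map (false ∷_) vs))
  ≡⟨ cong sum (map-++ g (map (true ∷_) vs) _) ⟩
    sum (map g (map (true ∷_) vs) List.++ map g (map (false ∷_) vs))
  ≡⟨ sum-++ (map g (map (true ∷_) vs)) _ ⟩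
    sum (map g (map (true ∷_) vs)) + sum (map g (map (false ∷_) vs))
  ≡⟨ sym (cong₂ _+_ (cong sum (map-∘ {g = g} {f = true ∷_} vs)) (cong sum (map-∘ {g = g} {f = false ∷_} vs))) ⟩
    sum (map (g ∘ (true ∷_)) vs) + sum (map (g ∘ (false ∷_)) vs)
  ∎
  where
  vs = allVecs n

sum-allVecs-++ : ∀ ℓ {m} (g : Vec Bool (ℓ + m) → ℕ) →
  sum (map g (allVecs (ℓ + m)))
    ≡ sum (map (λ a → sum (map (λ ys → g (a ++ ys)) (allVecs m))) (allVecs ℓ))
sum-allVecs-++ zero    g = sym (+-identityʳ _)
sum-allVecs-++ (suc ℓ) {m} g = begin
    sum (map g (allVecs (suc ℓ + m)))
  ≡⟨ sum-allVecs-suc g ⟩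
    sum (map (g ∘ (true ∷_)) (allVecs (ℓ + m))) + sum (map (g ∘ (false ∷_)) (allVecs (ℓ + m)))
  ≡⟨ cong₂ _+_ (sum-allVecs-++ ℓ (g ∘ (true ∷_))) (sum-allVecs-++ ℓ (g ∘ (false ∷_))) ⟩
    _
  ≡⟨ sym (sum-allVecs-suc (λ a → sum (map (λ ys → g (a ++ ys)) (allVecs m)))) ⟩
    sum (map (λ a → sum (map (λ ys → g (a ++ ys)) (allVecs m))) (allVecs (suc ℓ)))
  ∎

count-allVecs-suc : ∀ {n} (f : Vec Bool (suc n) → Bool) →
  count f (allVecs (suc n)) ≡ count (f ∘ (true ∷_)) (allVecs n) + count (f ∘ (false ∷_)) (allVecs n)
count-allVecs-suc f = sum-allVecs-suc (λ y → if f y then 1 else 0)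

zeros : ∀ {n} → Vec Bool n → ℕ
zeros []          = 0
zeros (true  ∷ v) = zeros v
zeros (false ∷ v) = suc (zeros v)

weight+zeros : ∀ {n} (v : Vec Bool n) → weight v + zeros v ≡ n
weight+zeros []          = refl
weight+zeros (true  ∷ v) = cong suc (weight+zeros v)
weight+zeros (false ∷ v) = trans (+-suc (weight v) (zeros v)) (cong suc (weight+zeros v))

weight-++ : ∀ {ℓ m} (a : Vec Bool ℓ) (t : Vec Bool m) → weight (a ++ t) ≡ weight a + weight t
weight-++ []          t = refl
weight-++ (true  ∷ a) t = cong suc (weight-++ a t)
weight-++ (false ∷ a) t = weight-++ a t

excess : ∀ {n} → Vec Bool n → Vec Bool n → ℕ
excess []          []          = 0
excess (true  ∷ x) (true  ∷ y) = excess x y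
excess (true  ∷ x) (false ∷ y) = suc (excess x y)
excess (false ∷ x) (_     ∷ y) = excess x y

excess-++ : ∀ {ℓ m} (a a' : Vec Bool ℓ) (t ys : Vec Bool m) →
  excess (a ++ t) (a' ++ ys) ≡ excess a a' + excess t ys
excess-++ []          []           t ys = refl
excess-++ (true  ∷ a) (true  ∷ a') t ys = excess-++ a a' t ys
excess-++ (true  ∷ a) (false ∷ a') t ys = cong suc (excess-++ a a' t ys)
excess-++ (false ∷ a) (_     ∷ a') t ys = excess-++ a a' t ys

weight≡common+excess : ∀ {n} (x y : Vec Bool n) → weight x ≡ common x y + excess x y
weight≡common+excess []          []          = refl
weight≡common+excess (true  ∷ x) (true  ∷ y) = cong suc (weight≡common+excess x y)
weight≡common+excess (true  ∷ x) (false ∷ y) =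
  trans (cong suc (weight≡common+excess x y)) (sym (+-suc (common x y) (excess x y)))
weight≡common+excess (false ∷ x) (true  ∷ y) = weight≡common+excess x y
weight≡common+excess (false ∷ x) (false ∷ y) = weight≡common+excess x y

common-comm : ∀ {n} (x y : Vec Bool n) → common x y ≡ common y x
common-comm x y = cong weight (zipWith-comm ∧-comm x y)

one-more : ∀ {c e v} → c + e ≡ suc v → c ≡ v → e ≡ 1
one-more {c} {e} c+e≡ refl = +-cancelˡ-≡ c e 1 (trans c+e≡ (+-comm 1 c))

one-less : ∀ {c e v} → c + e ≡ suc v → e ≡ 1 → c ≡ v
one-less {c} c+e≡ refl = suc-injective (trans (+-comm 1 c) c+e≡)

adjacent⇔swap : ∀ {n v} (x y : Vec Bool n) → weight x ≡ suc v →
  (weight y ≡ suc v × common x y ≡ v) ⇔ (excess x y ≡ 1 × excess y x ≡ 1)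
adjacent⇔swap {v = v} x y wx = mk⇔ to from
  where
  c = common x y

  split-x : c + excess x y ≡ suc v
  split-x = trans (sym (weight≡common+excess x y)) wx

  split-y : weight y ≡ c + excess y x
  split-y = trans (weight≡common+excess y x) (cong (_+ excess y x) (common-comm y x))

  to : weight y ≡ suc v × c ≡ v → excess x y ≡ 1 × excess y x ≡ 1
  to (wy , c≡v) = one-more split-x c≡v , one-more (trans (sym split-y) wy) c≡v

  from : excess x y ≡ 1 × excess y x ≡ 1 → weight y ≡ suc v × c ≡ v
  from (exy , eyx) = trans split-y (trans (cong (c +_) eyx) (trans (+-comm c 1) (cong suc c≡v))) , c≡v
    where
    c≡v : c ≡ v
    c≡v = one-less split-x exy

-- Binomial count of tails with prescribed changes

changes-count : ∀ {m} (t : Vec Bool m) i j →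
  count (λ ys → (excess t ys ≡ᵇ i) ∧ (excess ys t ≡ᵇ j)) (allVecs m)
    ≡ (weight t C i) * (zeros t C j)
changes-count []         zero    zero    = refl
changes-count []         zero    (suc j) = refl
changes-count []         (suc i) j       = refl
changes-count {suc m} (true ∷ t) i j =
  trans (count-allVecs-suc (λ ys → (excess (true ∷ t) ys ≡ᵇ i) ∧ (excess ys (true ∷ t) ≡ᵇ j))) (keep-or-drop i)
  where
  Z = zeros t C j

  -- the first one of t is either kept or turned into a zero
  keep-or-drop : ∀ i →
    count (λ ys → (excess t ys ≡ᵇ i) ∧ (excess ys t ≡ᵇ j)) (allVecs m)
      + count (λ ys → (suc (excess t ys) ≡ᵇ i) ∧ (excess ys t ≡ᵇ j)) (allVecs m)
      ≡ (suc (weight t) C i) * Z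
  keep-or-drop zero =
    trans (cong₂ _+_ (changes-count t 0 j) (count-none (λ _ → refl) (allVecs m))) (+-identityʳ _)
  keep-or-drop (suc i) = begin
      _
    ≡⟨ cong₂ _+_ (changes-count t (suc i) j) (changes-count t i j) ⟩
      (weight t C suc i) * Z + (weight t C i) * Z
    ≡⟨ sym (*-distribʳ-+ Z (weight t C suc i) (weight t C i)) ⟩
      ((weight t C suc i) + (weight t C i)) * Z
    ≡⟨ cong (_* Z) (trans (+-comm (weight t C suc i) (weight t C i)) (nCk+nC[k+1]≡[n+1]C[k+1] (weight t) i)) ⟩
      (suc (weight t) C suc i) * Z
    ∎
changes-count {suc m} (false ∷ t) i j =
  trans (count-allVecs-suc (λ ys → (excess (false ∷ t) ys ≡ᵇ i) ∧ (excess ys (false ∷ t) ≡ᵇ j))) (set-or-keep j)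
  where
  P = weight t C i

  -- the first zero of t is either turned into a one or kept
  set-or-keep : ∀ j →
    count (λ ys → (excess t ys ≡ᵇ i) ∧ (suc (excess ys t) ≡ᵇ j)) (allVecs m)
      + count (λ ys → (excess t ys ≡ᵇ i) ∧ (excess ys t ≡ᵇ j)) (allVecs m)
      ≡ P * (suc (zeros t) C j)
  set-or-keep zero =
    cong₂ _+_ (count-none (λ ys → ∧-zeroʳ (excess t ys ≡ᵇ i)) (allVecs m)) (changes-count t i 0)
  set-or-keep (suc j) = begin
      _
    ≡⟨ cong₂ _+_ (changes-count t i j) (changes-count t i (suc j)) ⟩
      P * (zeros t C j) + P * (zeros t C suc j)
    ≡⟨ sym (*-distribˡ-+ P (zeros t C j) (zeros t C suc j)) ⟩
      P * ((zeros t C j) + (zeros t C suc j))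
    ≡⟨ cong (P *_) (nCk+nC[k+1]≡[n+1]C[k+1] (zeros t) j) ⟩
      P * (suc (zeros t) C suc j)
    ∎

-- Linear, bilinear and quadratic polynomials with natural coefficients

record Linear : Set where
  constructor linear
  field slope intercept : ℕ

⟦_⟧ₗ : Linear → ℕ → ℕ
⟦ linear a b ⟧ₗ n = a * n + b

record Bilinear : Set where
  constructor bilinear
  field coeff-pz coeff-p coeff-z constant : ℕ

⟦_⟧ : Bilinear → ℕ → ℕ → ℕ
⟦ bilinear α β γ δ ⟧ p z = α * (p * z) + β * p + γ * z + δ

𝟘 : Bilinear
𝟘 = bilinear 0 0 0 0

_⊕_ : Bilinear → Bilinear → Bilinear
bilinear α β γ δ ⊕ bilinear α' β' γ' δ' = bilinear (α + α') (β + β') (γ + γ') (δ + δ')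

_⊗_ : Linear → Linear → Bilinear
linear a b ⊗ linear c d = bilinear (a * c) (a * d) (b * c) (b * d)

⟦⊕⟧ : ∀ P Q p z → ⟦ P ⊕ Q ⟧ p z ≡ ⟦ P ⟧ p z + ⟦ Q ⟧ p z
⟦⊕⟧ (bilinear α β γ δ) (bilinear α' β' γ' δ') p z = identity α β γ δ α' β' γ' δ' p z
  where
  identity : ∀ α β γ δ α' β' γ' δ' p z →
    (α + α') * (p * z) + (β + β') * p + (γ + γ') * z + (δ + δ')
      ≡ α * (p * z) + β * p + γ * z + δ + (α' * (p * z) + β' * p + γ' * z + δ')
  identity = solve-∀

⟦⊗⟧ : ∀ f g p z → ⟦ f ⊗ g ⟧ p z ≡ ⟦ f ⟧ₗ p * ⟦ g ⟧ₗ z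
⟦⊗⟧ (linear a b) (linear c d) p z = identity a b c d p z
  where
  identity : ∀ a b c d p z →
    a * c * (p * z) + a * d * p + b * c * z + b * d ≡ (a * p + b) * (c * z + d)
  identity = solve-∀

Σ⊕ : {A : Set} → List A → (A → Bilinear) → Bilinear
Σ⊕ []       f = 𝟘
Σ⊕ (x ∷ xs) f = f x ⊕ Σ⊕ xs f

⟦Σ⊕⟧ : ∀ {A : Set} (xs : List A) (f : A → Bilinear) p z →
  ⟦ Σ⊕ xs f ⟧ p z ≡ sum (map (λ x → ⟦ f x ⟧ p z) xs)
⟦Σ⊕⟧ []       f p z = refl
⟦Σ⊕⟧ (x ∷ xs) f p z = trans (⟦⊕⟧ (f x) (Σ⊕ xs f) p z) (cong (⟦ f x ⟧ p z +_) (⟦Σ⊕⟧ xs f p z))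

⟦guard⟧ : ∀ b P p z → ⟦ if b then P else 𝟘 ⟧ p z ≡ (if b then ⟦ P ⟧ p z else 0)
⟦guard⟧ true  P p z = refl
⟦guard⟧ false P p z = refl

Quadratic : Set
Quadratic = ℕ × ℕ × ℕ

⟦_⟧² : Quadratic → ℕ → ℕ
⟦ A , B , K ⟧² n = A * (n * n) + B * n + K

_≟²_ : (q r : Quadratic × Quadratic) → Dec (q ≡ r)
_≟²_ = ≡-dec quadratic-≟ quadratic-≟
  where
  quadratic-≟ : (q r : Quadratic) → Dec (q ≡ r)
  quadratic-≟ = ≡-dec _≟_ (≡-dec _≟_ _≟_)

expand : ℕ → ℕ → Bilinear → Quadratic
expand d k (bilinear α β γ δ) = α , α * (d + k) + β + γ , α * (d * k) + β * d + γ * k + δ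

expand-correct : ∀ d k P n → ⟦ P ⟧ (n + d) (n + k) ≡ ⟦ expand d k P ⟧² n
expand-correct d k (bilinear α β γ δ) n = identity α β γ δ d k n
  where
  identity : ∀ α β γ δ d k n →
    α * ((n + d) * (n + k)) + β * (n + d) + γ * (n + k) + δ
      ≡ α * (n * n) + (α * (d + k) + β + γ) * n + (α * (d * k) + β * d + γ * k + δ)
  identity = solve-∀

-- Neighbour counts of sets defined by prefixes

-- If the prefix change already moved L ones, the tail must move 1 ∸ L more:
-- one of its n candidates (L = 0), none (L = 1), or it is impossible (L ≥ 2).
lin : ℕ → Linear
lin 0             = linear 1 0
lin 1             = linear 0 1
lin (suc (suc _)) = linear 0 0

C1-lin : ∀ n → n C 1 ≡ ⟦ lin 0 ⟧ₗ n
C1-lin n = sym (trans (+-identityʳ (1 * n)) (trans (*-identityˡ n) (sym (nC1≡n n))))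

tailCount : ∀ {m} L G (t : Vec Bool m) →
  count (λ ys → (L + excess t ys ≡ᵇ 1) ∧ (G + excess ys t ≡ᵇ 1)) (allVecs m)
    ≡ ⟦ lin L ⟧ₗ (weight t) * ⟦ lin G ⟧ₗ (zeros t)
tailCount {m} (suc (suc _)) G t = count-none (λ _ → refl) (allVecs m)
tailCount {m} 0 (suc (suc _)) t =
  trans (count-none (λ ys → ∧-zeroʳ (excess t ys ≡ᵇ 1)) (allVecs m)) (sym (*-zeroʳ (⟦ lin 0 ⟧ₗ (weight t))))
tailCount {m} 1 (suc (suc _)) t =
  trans (count-none (λ ys → ∧-zeroʳ (excess t ys ≡ᵇ 0)) (allVecs m)) (sym (*-zeroʳ (⟦ lin 1 ⟧ₗ (weight t))))
tailCount {m} 0 0 t = trans (changes-count t 1 1) (cong₂ _*_ (C1-lin (weight t)) (C1-lin (zeros t)))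
tailCount {m} 0 1 t = trans (changes-count t 1 0) (cong (_* 1) (C1-lin (weight t)))
tailCount {m} 1 0 t = trans (changes-count t 0 1) (cong (1 *_) (C1-lin (zeros t)))
tailCount {m} 1 1 t = changes-count t 0 0

-- The neighbour-count polynomial of a prefix a for the prefix class inS:
-- every prefix a' of the class contributes the tails completing a single swap.
neighbourPoly : ∀ {ℓ} → (Vec Bool ℓ → Bool) → Vec Bool ℓ → Bilinear
neighbourPoly inS a =
  Σ⊕ (allVecs _) (λ a' → if inS a' then lin (excess a a') ⊗ lin (excess a' a) else 𝟘)

neighbours-as-count : ∀ n w (S : Pred (Vec Bool n) 0ℓ) (S? : Decidable S) x →
  neighboursIn n w S S? x
    ≡ count (λ y → does (isVertex? n w y) ∧ does (adj? n w x y ×-dec S? y)) (allVecs n)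
neighbours-as-count n w S S? x =
  trans (length-filter Q (vertices n w)) (count-filter (isVertex? n w) (λ y → does (Q y)) (allVecs n))
  where
  Q : Decidable (λ y → Adj n w x y × S y)
  Q y = adj? n w x y ×-dec S? y

prefixNeighbours : ∀ ℓ {m v} (S : Pred (Vec Bool (ℓ + m)) 0ℓ) (S? : Decidable S)
  (inS : Vec Bool ℓ → Bool) → (∀ a' ys → does (S? (a' ++ ys)) ≡ inS a') →
  ∀ (a : Vec Bool ℓ) t → weight (a ++ t) ≡ suc v →
  neighboursIn (ℓ + m) (suc v) S S? (a ++ t) ≡ ⟦ neighbourPoly inS a ⟧ (weight t) (zeros t)
prefixNeighbours ℓ {m} {v} S S? inS prefixS a t wx = begin
    neighboursIn (ℓ + m) (suc v) S S? x
  ≡⟨ neighbours-as-count (ℓ + m) (suc v) S S? x ⟩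
    count F (allVecs (ℓ + m))
  ≡⟨ sum-allVecs-++ ℓ (λ y → if F y then 1 else 0) ⟩
    sum (map (λ a' → count (λ ys → F (a' ++ ys)) (allVecs m)) (allVecs ℓ))
  ≡⟨ cong sum (map-cong perPrefix (allVecs ℓ)) ⟩
    sum (map (λ a' → ⟦ term a' ⟧ p z) (allVecs ℓ))
  ≡⟨ sym (⟦Σ⊕⟧ (allVecs ℓ) term p z) ⟩
    ⟦ neighbourPoly inS a ⟧ p z
  ∎
  where
  x = a ++ t
  p = weight t
  z = zeros t

  F : Vec Bool (ℓ + m) → Bool
  F y = does (isVertex? (ℓ + m) (suc v) y) ∧ does (adj? (ℓ + m) (suc v) x y ×-dec S? y)

  term : Vec Bool ℓ → Bilinear
  term a' = if inS a' then lin (excess a a') ⊗ lin (excess a' a) else 𝟘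

  swapTest : Vec Bool ℓ → Vec Bool m → Bool
  swapTest a' ys = (excess a a' + excess t ys ≡ᵇ 1) ∧ (excess a' a + excess ys t ≡ᵇ 1)

  neighbourTest : ∀ a' ys → F (a' ++ ys) ≡ inS a' ∧ swapTest a' ys
  neighbourTest a' ys = begin
      vertex ∧ (adjacent ∧ does (S? y))
    ≡⟨ trans (sym (∧-assoc vertex adjacent _)) (∧-comm (vertex ∧ adjacent) _) ⟩
      does (S? y) ∧ (vertex ∧ adjacent)
    ≡⟨ cong₂ _∧_ (prefixS a' ys)
         (does-⇔ (adjacent⇔swap x y wx) ((weight y ≟ suc v) ×-dec (common x y ≟ v))
                                         ((excess x y ≟ 1) ×-dec (excess y x ≟ 1))) ⟩
      inS a' ∧ ((excess x y ≡ᵇ 1) ∧ (excess y x ≡ᵇ 1))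
    ≡⟨ cong (inS a' ∧_) (cong₂ (λ l g → (l ≡ᵇ 1) ∧ (g ≡ᵇ 1)) (excess-++ a a' t ys) (excess-++ a' a ys t)) ⟩
      inS a' ∧ swapTest a' ys
    ∎
    where
    y = a' ++ ys
    vertex = does (isVertex? (ℓ + m) (suc v) y)
    adjacent = does (adj? (ℓ + m) (suc v) x y)

  perPrefix : ∀ a' → count (λ ys → F (a' ++ ys)) (allVecs m) ≡ ⟦ term a' ⟧ p z
  perPrefix a' = begin
      count (λ ys → F (a' ++ ys)) (allVecs m)
    ≡⟨ count-cong (neighbourTest a') (allVecs m) ⟩
      count (λ ys → inS a' ∧ swapTest a' ys) (allVecs m)
    ≡⟨ count-guard (inS a') (swapTest a') (allVecs m) ⟩
      (if inS a' then count (swapTest a') (allVecs m) else 0)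
    ≡⟨ cong (λ c → if inS a' then c else 0)
         (trans (tailCount (excess a a') (excess a' a) t) (sym (⟦⊗⟧ (lin (excess a a')) _ p z))) ⟩
      (if inS a' then ⟦ lin (excess a a') ⊗ lin (excess a' a) ⟧ p z else 0)
    ≡⟨ sym (⟦guard⟧ (inS a') _ p z) ⟩
      ⟦ term a' ⟧ p z
    ∎

tailShape : ∀ {ℓ m} n (a : Vec Bool ℓ) (t : Vec Bool m) →
  weight (a ++ t) ≡ ℓ + n → ℓ + m ≡ 2 * (ℓ + n) →
  weight t ≡ n + zeros a × zeros t ≡ n + weight a
tailShape {ℓ} {m} n a t wx balanced = ones , noughts
  where
  k = weight a
  d = zeros a
  kd : k + d ≡ ℓ
  kd = weight+zeros a

  ones : weight t ≡ n + d
  ones = +-cancelˡ-≡ k (weight t) (n + d) (begin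
      k + weight t      ≡⟨ sym (weight-++ a t) ⟩
      weight (a ++ t)   ≡⟨ wx ⟩
      ℓ + n             ≡⟨ cong (_+ n) (sym kd) ⟩
      k + d + n         ≡⟨ trans (+-assoc k d n) (cong (k +_) (+-comm d n)) ⟩
      k + (n + d)       ∎)

  double : ∀ k d n → 2 * (k + d + n) ≡ k + d + (n + d) + (n + k)
  double = solve-∀

  noughts : zeros t ≡ n + k
  noughts = +-cancelˡ-≡ (ℓ + (n + d)) (zeros t) (n + k) (begin
      ℓ + (n + d) + zeros t        ≡⟨ cong (λ q → ℓ + q + zeros t) (sym ones) ⟩
      ℓ + weight t + zeros t       ≡⟨ trans (+-assoc ℓ _ _) (cong (ℓ +_) (weight+zeros t)) ⟩
      ℓ + m                        ≡⟨ balanced ⟩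
      2 * (ℓ + n)                  ≡⟨ cong (λ l → 2 * (l + n)) (sym kd) ⟩
      2 * (k + d + n)              ≡⟨ double k d n ⟩
      k + d + (n + d) + (n + k)    ≡⟨ cong (λ l → l + (n + d) + (n + k)) kd ⟩
      ℓ + (n + d) + (n + k)        ∎)

inB : Vec Bool 5 → Bool
inB a = does (DecMem._∈?_ (VecP.≡-dec BoolP._≟_) a B)

prefix-C₁ : ∀ {m} (a : Vec Bool 5) (ys : Vec Bool m) → does (C₁? m (a ++ ys)) ≡ inB a
prefix-C₁ (_ ∷ _ ∷ _ ∷ _ ∷ _ ∷ []) ys = refl

profile : Vec Bool 5 → Quadratic × Quadratic
profile a = expand (zeros a) (weight a) (neighbourPoly inB a)
          , expand (zeros a) (weight a) (neighbourPoly (not ∘ inB) a)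

-- the rows of the quotient matrix as quadratics in n = w ∸ 5
quotientRow : Bool → Quadratic × Quadratic
quotientRow true  = (1 , 8 , 15) , (0 , 2 , 10)
quotientRow false = (0 , 2 , 8)  , (1 , 8 , 17)

profile-check : ∀ a → profile a ≡ quotientRow (inB a)
profile-check a = All.lookup allPrefixes (allVecs-complete a)
  where
  allPrefixes : All (λ a → profile a ≡ quotientRow (inB a)) (allVecs 5)
  allPrefixes = toWitness {a? = all? (λ a → profile a ≟² quotientRow (inB a)) (allVecs 5)} tt

neighbourCounts : ∀ {b} n m (x : Vec Bool (5 + m)) → does (C₁? m x) ≡ b →
  weight x ≡ 5 + n → 5 + m ≡ 2 * (5 + n) →
  neighboursIn (5 + m) (5 + n) (C₁ m) (C₁? m) x ≡ ⟦ proj₁ (quotientRow b) ⟧² n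
  × neighboursIn (5 + m) (5 + n) (λ y → ¬ C₁ m y) (λ y → ¬? (C₁? m y)) x ≡ ⟦ proj₂ (quotientRow b) ⟧² n
neighbourCounts n m (x₀ ∷ x₁ ∷ x₂ ∷ x₃ ∷ x₄ ∷ t) refl wx balanced =
    trans (classCount inB (C₁ m) (C₁? m) prefix-C₁) (cong (λ r → ⟦ proj₁ r ⟧² n) (profile-check a))
  , trans (classCount (not ∘ inB) (λ y → ¬ C₁ m y) (λ y → ¬? (C₁? m y)) (λ a' ys → cong not (prefix-C₁ a' ys)))
          (cong (λ r → ⟦ proj₂ r ⟧² n) (profile-check a))
  where
  a = x₀ ∷ x₁ ∷ x₂ ∷ x₃ ∷ x₄ ∷ []

  classCount : (inS : Vec Bool 5 → Bool) (S : Pred (Vec Bool (5 + m)) 0ℓ) (S? : Decidable S) →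
    (∀ a' ys → does (S? (a' ++ ys)) ≡ inS a') →
    neighboursIn (5 + m) (5 + n) S S? (a ++ t) ≡ ⟦ expand (zeros a) (weight a) (neighbourPoly inS a) ⟧² n
  classCount inS S S? prefixS = begin
      neighboursIn (5 + m) (5 + n) S S? (a ++ t)
    ≡⟨ prefixNeighbours 5 S S? inS prefixS a t wx ⟩
      ⟦ neighbourPoly inS a ⟧ (weight t) (zeros t)
    ≡⟨ cong₂ ⟦ neighbourPoly inS a ⟧ ones noughts ⟩
      ⟦ neighbourPoly inS a ⟧ (n + zeros a) (n + weight a)
    ≡⟨ expand-correct (zeros a) (weight a) (neighbourPoly inS a) n ⟩
      ⟦ expand (zeros a) (weight a) (neighbourPoly inS a) ⟧² n
    ∎
    where
    ones = proj₁ (tailShape n a t wx balanced)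
    noughts = proj₂ (tailShape n a t wx balanced)

∸-intro : ∀ {a b c} → a + b ≡ c → a ≡ c ∸ b
∸-intro {a} {b} a+b≡c = trans (sym (m+n∸n≡m a b)) (cong (_∸ b) a+b≡c)

-- (w − 2) w + 2 w = w² at w = 5 + n
square : ∀ n → 1 * (n * n) + 8 * n + 15 + 2 * (5 + n) ≡ (5 + n) * (5 + n)
square = solve-∀

inside-row : ∀ n {c₁ c₂} → c₁ ≡ ⟦ 1 , 8 , 15 ⟧² n × c₂ ≡ ⟦ 0 , 2 , 10 ⟧² n →
  c₁ ≡ (5 + n) * (5 + n) ∸ 2 * (5 + n) × c₂ ≡ 2 * (5 + n)
inside-row n (e₁ , e₂) = trans e₁ (∸-intro (square n)) , trans e₂ (double n)
  where
  double : ∀ n → 0 * (n * n) + 2 * n + 10 ≡ 2 * (5 + n)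
  double = solve-∀

outside-row : ∀ n {c₁ c₂} → c₁ ≡ ⟦ 0 , 2 , 8 ⟧² n × c₂ ≡ ⟦ 1 , 8 , 17 ⟧² n →
  c₁ ≡ 2 * (5 + n) ∸ 2 × c₂ ≡ (5 + n) * (5 + n) ∸ 2 * (5 + n) + 2
outside-row n (e₁ , e₂) =
  trans e₁ (∸-intro (double-minus n)) , trans e₂ (trans (plus-two n) (cong (_+ 2) (∸-intro (square n))))
  where
  double-minus : ∀ n → 0 * (n * n) + 2 * n + 8 + 2 ≡ 2 * (5 + n)
  double-minus = solve-∀
  plus-two : ∀ n → 1 * (n * n) + 8 * n + 17 ≡ 1 * (n * n) + 8 * n + 15 + 2
  plus-two = solve-∀

-- Matching on 5 ≤ w writes w = 5 + n; each vertex then gets the row of its side.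
mainTheorem4 : (w m : ℕ) → 5 ≤ w → 5 + m ≡ 2 * w →
    IsEquitable2 (5 + m) w (C₁ m) (C₁? m)
      (w * w ∸ 2 * w) (2 * w) (2 * w ∸ 2) (w * w ∸ 2 * w + 2)
mainTheorem4 _ m (s≤s (s≤s (s≤s (s≤s (s≤s (z≤n {n})))))) balanced =
    (λ x wx x∈C₁ → inside-row n (neighbourCounts n m x (dec-true (C₁? m x) x∈C₁) wx balanced))
  , (λ x wx x∉C₁ → outside-row n (neighbourCounts n m x (dec-false (C₁? m x) x∉C₁) wx balanced))
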